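{- Let $i\ge 1$ and consider a clause-database state with parameter $i$ (as in the context) satisfying all four invariants with $n=i$. Form a new state with parameter $i-1$ as follows: every clause of $D_i$ is either discarded or added to $D_\infty$; for every $q\in\{0,\ldots,i-1\}$, all clauses of $S_i^q$ are removed from $S_i^q$ and added to $D_q$; all other groups are unchanged (and the groups $D_i$, $S_i^q$ no longer exist). Then, with the trail $\tau$ unchanged, the new state satisfies all four invariants with $n=i-1$.
   Context: A clause is a finite set of pairwise distinct literals (read as their disjunction); a finite set of clauses is read as their conjunction (the empty set is true). Fix a CNF formula $I$ (the input clauses) and a trail $\tau=\langle \ell_1@d_1,\ldots,\ell_k@d_k\rangle$: a finite sequence of literals over pairwise distinct variables, each annotated with a decision level $d_j\in\mathbb{N}$, with $d_1\le\cdots\le d_k$ (and such that every literal that is not the first literal of its positive level is implied by $I$ together with the earlier first-literals-of-levels). For $d\in\mathbb{N}$, $\tau^{\le d}$ is the subsequence of literals with level $\le d$, viewed as a partial assignment. For a formula $\varphi$, $\tau^{\le d}\models\varphi$ means every total assignment extending $\tau^{\le d}$ satisfies $\varphi$. Write $\varphi\to^d\psi$ if $\tau^{\le d}\models(\varphi\to\psi)$ and $\varphi\leftrightarrow^d\psi$ if $\tau^{\le d}\models(\varphi\leftrightarrow\psi)$. A clause-database state with parameter $n$ consists of pairwise disjoint finite sets of clauses: active groups $D_0,D_1,\ldots,D_n,D_\infty$ and stashed groups $S_k^q$ for $1\le k\le n$, $0\le q<k$. Notation: $S_k=\bigcup_{q<k}S_k^q$; $S=\bigcup_{k=1}^n S_k$;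 $S^i=\bigcup_{k} S_k^i$; $P=D_0\cup S^0$; $D=D_1\cup\cdots\cup D_n$; $N=D_0\cup D$; $A=N\cup D_\infty$. Invariants (for parameter $n$): (Input-equivalence) $I\leftrightarrow^0 P$. (Correctness) $N\leftrightarrow^n P$. (Representation) for every $i'$ with $1\le i'\le n$ and every $\alpha\in S_{i'}$, at least one of: (a) there are $r$ with $0\le r\le i'$ and $\beta\in D_r$ with $\beta\to^{i'}\alpha$; (b) there are $r\le i'$, $j$ with $i'<j\le n$, and $\beta\in S_j^r$ with $\beta\to^{i'}\alpha$; (c) $\tau^{\le i'}\models\alpha$. (Closure) for every $\gamma\in A\cup S$, $P\to^0\gamma$. -}

module Defs where

open import Data.Nat using (ℕ; zero; suc; _≤_; _<_)
open import Data.Bool using (Bool; true; false)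
open import Data.List using (List; []; _∷_; _++_; map)
open import Data.List.Membership.Propositional using (_∈_)
open import Data.List.Relation.Unary.All using (All)
open import Data.List.Relation.Unary.Any using (Any)
open import Data.List.Relation.Unary.Unique.Propositional using (Unique)
open import Data.List.Relation.Unary.Linked using (Linked)
open import Data.Product using (Σ; _×_; _,_; proj₁; proj₂)
open import Data.Sum using (_⊎_)
open import Data.Empty using (⊥)
open import Data.Unit using (⊤)
open import Relation.Binary.PropositionalEquality using (_≡_; _≢_)
open import Relation.Nullary using (¬_)

-- Variables are natural numbers; a literal is a variable with a polarity
-- (pos = true : the variable itself, pos = false : its negation).
record Literal : Set where
  constructor lit
  field
    var : ℕ
    pos : Bool
open Literal public

Clause : Set
Clause = List Literal

WFClause : Clause → Set
WFClause c = Unique c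

SameClause : Clause → Clause → Set
SameClause c c' = (∀ l → l ∈ c → l ∈ c') × (∀ l → l ∈ c' → l ∈ c)

Assignment : Set
Assignment = ℕ → Bool

LitTrue : Assignment → Literal → Set
LitTrue σ l = σ (var l) ≡ pos l

Formula : Set₁
Formula = Assignment → Set

⟦_⟧ᶜ : Clause → Formula
⟦ c ⟧ᶜ σ = Any (LitTrue σ) c

⟦_⟧ᶠ : List Clause → Formula
⟦ F ⟧ᶠ σ = All (λ c → ⟦ c ⟧ᶜ σ) F

⟦_⟧ˢ : (Clause → Set) → Formula
⟦ X ⟧ˢ σ = ∀ c → X c → ⟦ c ⟧ᶜ σ

-- A trail is a sequence of literals annotated with decision levels.
Trail : Set
Trail = List (Literal × ℕ)

-- The entry at the end of the prefix `pre` with level d is the first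
-- literal of its positive level d.
IsDecision : Trail → ℕ → Set
IsDecision pre d = (0 < d) × All (λ e → proj₂ e ≢ d) pre

ImpliedBy : List Clause → Trail → Literal → Set
ImpliedBy I pre l =
  ∀ (σ : Assignment) → ⟦ I ⟧ᶠ σ →
    (∀ p₁ l' d' p₂ → pre ≡ p₁ ++ ((l' , d') ∷ p₂) → IsDecision p₁ d' → LitTrue σ l') →
    LitTrue σ l

record WFTrail (I : List Clause) (τ : Trail) : Set where
  field
    distinctVars : Unique (map (λ e → var (proj₁ e)) τ)
    sortedLevels : Linked (λ e e' → proj₂ e ≤ proj₂ e') τ
    implied      : ∀ pre l d post → τ ≡ pre ++ ((l , d) ∷ post) →
                   ¬ IsDecision pre d → ImpliedBy I pre l

Extends : Trail → ℕ → Assignment → Set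
Extends τ d σ = ∀ l d' → (l , d') ∈ τ → d' ≤ d → LitTrue σ l

Models : Trail → ℕ → Formula → Set
Models τ d φ = ∀ σ → Extends τ d σ → φ σ

Imp : Trail → ℕ → Formula → Formula → Set
Imp τ d φ ψ = Models τ d (λ σ → φ σ → ψ σ)

Iff : Trail → ℕ → Formula → Formula → Set
Iff τ d φ ψ = Models τ d (λ σ → (φ σ → ψ σ) × (ψ σ → φ σ))

-- The groups are stored as functions of their indices; for parameter n
-- only D r (r ≤ n), D∞ and S k q (1 ≤ k ≤ n, q < k) are groups, the
-- other values are ignored.
record DB : Set where
  constructor db
  field
    D  : ℕ → List Clause
    D∞ : List Clause
    S  : ℕ → ℕ → List Clause
open DB public

data GroupId : Set where
  gD   : ℕ → GroupId
  gInf : GroupId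
  gS   : ℕ → ℕ → GroupId

ValidGroup : ℕ → GroupId → Set
ValidGroup n (gD r)   = r ≤ n
ValidGroup n gInf     = ⊤
ValidGroup n (gS k q) = (1 ≤ k) × (k ≤ n) × (q < k)

group : DB → GroupId → List Clause
group st (gD r)   = D st r
group st gInf     = D∞ st
group st (gS k q) = S st k q

record IsState (n : ℕ) (st : DB) : Set where
  field
    wfClauses : ∀ g → ValidGroup n g → All WFClause (group st g)
    disjoint  : ∀ g g' → ValidGroup n g → ValidGroup n g' → g ≢ g' →
                ∀ c c' → c ∈ group st g → c' ∈ group st g' → ¬ SameClause c c'

module Sets (n : ℕ) (st : DB) where
  inSk : ℕ → Clause → Set
  inSk k c = Σ ℕ λ q → (q < k) × (c ∈ S st k q)
  inS : Clause → Set
  inS c = Σ ℕ λ k → (1 ≤ k) × (k ≤ n) × inSk k c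
  inP : Clause → Set
  inP c = (c ∈ D st 0) ⊎ (Σ ℕ λ k → (1 ≤ k) × (k ≤ n) × (c ∈ S st k 0))
  inD : Clause → Set
  inD c = Σ ℕ λ r → (1 ≤ r) × (r ≤ n) × (c ∈ D st r)
  inN : Clause → Set
  inN c = (c ∈ D st 0) ⊎ inD c
  inA : Clause → Set
  inA c = inN c ⊎ (c ∈ D∞ st)

record Invariants (I : List Clause) (τ : Trail) (n : ℕ) (st : DB) : Set where
  open Sets n st
  field
    inputEquivalence : Iff τ 0 ⟦ I ⟧ᶠ ⟦ inP ⟧ˢ
    correctness      : Iff τ n ⟦ inN ⟧ˢ ⟦ inP ⟧ˢ
    representation   :
      ∀ i' → 1 ≤ i' → i' ≤ n → ∀ α → inSk i' α →
        (Σ ℕ λ r → Σ Clause λ β →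
           (r ≤ i') × (β ∈ D st r) × Imp τ i' ⟦ β ⟧ᶜ ⟦ α ⟧ᶜ)
        ⊎ (Σ ℕ λ r → Σ ℕ λ j → Σ Clause λ β →
           (r ≤ i') × (i' < j) × (j ≤ n) × (β ∈ S st j r) × Imp τ i' ⟦ β ⟧ᶜ ⟦ α ⟧ᶜ)
        ⊎ Models τ i' ⟦ α ⟧ᶜ
    closure          : ∀ γ → inA γ ⊎ inS γ → Imp τ 0 ⟦ inP ⟧ˢ ⟦ γ ⟧ᶜ

-- The transformation of the lemma (i = suc m): the clauses X ⊆ D_i are
-- kept and added to D_∞ (the rest of D_i is discarded), S_i^q is moved
-- into D_q for q < i, everything else is unchanged.  For the new
-- parameter m the entries D i and S i _ are no longer groups and are
-- ignored.
backtrackStep : ℕ → List Clause → DB → DB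
backtrackStep i X st = db (λ q → D st q ++ S st i q) (D∞ st ++ X) (S st)

{-# OPTIONS --safe #-}
module Submission where

-- P is unchanged as a set, the new A ∪ S lies inside the old one (the kept
-- clauses X come from D_i), and a representative in S_i^r now lies in D_r;
-- so input equivalence, closure and representation carry over, and closure
-- gives N from P.  Conversely, under τ^{≤ i-1} every clause of S_k follows
-- from N by downward induction on k: representation derives it from D_r
-- (r ≤ k), from S_j (j > k), or from the trail, and the top level S_i has
-- been moved into N.

open import Defs
open import Data.Nat using (ℕ; suc; zero; _≤_; _<_; _∸_; z≤n; s≤s)
open import Data.Nat.Properties
  using (≤-refl; ≤-trans; ≤-antisym; ≤-pred; <⇒≤; ≤-<-trans; m≤n⇒m≤1+n; m≤n⇒m<n∨m≡n; ≤-<-connex; ∸-monoʳ-<)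
open import Data.Nat.Induction using (<-wellFounded)
open import Induction.WellFounded using (Acc; acc)
open import Data.List using (List)
open import Data.List.Membership.Propositional using (_∈_)
open import Data.List.Membership.Propositional.Properties using (∈-++⁺ˡ; ∈-++⁺ʳ; ∈-++⁻)
open import Data.List.Relation.Unary.All using (All; lookup)
open import Data.Product using (Σ; _×_; _,_; proj₁; proj₂)
open import Data.Sum using (_⊎_; inj₁; inj₂)
open import Relation.Binary.PropositionalEquality using (refl)

Extends-antimono : ∀ {τ d d' σ} → d' ≤ d → Extends τ d σ → Extends τ d' σ
Extends-antimono d'≤d ext l d'' l∈τ d''≤d' = ext l d'' l∈τ (≤-trans d''≤d' d'≤d)

Models-mono : ∀ {τ d d' φ} → d ≤ d' → Models τ d φ → Models τ d' φ
Models-mono d≤d' τ⊨φ σ ext = τ⊨φ σ (Extends-antimono d≤d' ext)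

⟦⟧ˢ-antimono : ∀ {X Y : Clause → Set} {σ} → (∀ c → X c → Y c) → ⟦ Y ⟧ˢ σ → ⟦ X ⟧ˢ σ
⟦⟧ˢ-antimono X⊆Y σ⊨Y c c∈X = σ⊨Y c (X⊆Y c c∈X)

Iff-congʳ : ∀ {τ d φ} {X Y : Clause → Set} → (∀ c → X c → Y c) → (∀ c → Y c → X c) →
            Iff τ d φ ⟦ X ⟧ˢ → Iff τ d φ ⟦ Y ⟧ˢ
Iff-congʳ X⊆Y Y⊆X φ↔X σ ext =
  (λ σ⊨φ → ⟦⟧ˢ-antimono Y⊆X (proj₁ (φ↔X σ ext) σ⊨φ)) ,
  (λ σ⊨Y → proj₂ (φ↔X σ ext) (⟦⟧ˢ-antimono X⊆Y σ⊨Y))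

Representation : Trail → ℕ → DB → Set
Representation τ n st =
  ∀ i' → 1 ≤ i' → i' ≤ n → ∀ α → inSk i' α →
    (Σ ℕ λ r → Σ Clause λ β →
       (r ≤ i') × (β ∈ D st r) × Imp τ i' ⟦ β ⟧ᶜ ⟦ α ⟧ᶜ)
    ⊎ (Σ ℕ λ r → Σ ℕ λ j → Σ Clause λ β →
       (r ≤ i') × (i' < j) × (j ≤ n) × (β ∈ S st j r) × Imp τ i' ⟦ β ⟧ᶜ ⟦ α ⟧ᶜ)
    ⊎ Models τ i' ⟦ α ⟧ᶜ
  where open Sets n st

Closure : Trail → ℕ → DB → Set
Closure τ n st = ∀ γ → inA γ ⊎ inS γ → Imp τ 0 ⟦ inP ⟧ˢ ⟦ γ ⟧ᶜ
  where open Sets n st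

module _ (n : ℕ) (st : DB) where
  open Sets n st

  D-group⇒inN : ∀ {r c} → r ≤ n → c ∈ D st r → inN c
  D-group⇒inN {zero}  _   c∈D = inj₁ c∈D
  D-group⇒inN {suc r} r≤n c∈D = inj₂ (suc r , s≤s z≤n , r≤n , c∈D)

  closure⇒P→N : ∀ {τ d} → Closure τ n st → Imp τ d ⟦ inP ⟧ˢ ⟦ inN ⟧ˢ
  closure⇒P→N cl σ ext σ⊨P c c∈N = Models-mono z≤n (cl c (inj₁ (inj₁ c∈N))) σ ext σ⊨P

stashed-satisfied : ∀ {τ n st m σ} → Representation τ n st → Extends τ m σ →
  (∀ r β → r ≤ m → β ∈ D st r → ⟦ β ⟧ᶜ σ) →
  (∀ k α → m < k → k ≤ n → Sets.inSk n st k α → ⟦ α ⟧ᶜ σ) →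
  ∀ k α → 1 ≤ k → k ≤ n → Sets.inSk n st k α → ⟦ α ⟧ᶜ σ
stashed-satisfied {τ} {n} {st} {m} {σ} rep ext lowD highS k = go k (<-wellFounded (n ∸ k))
  where
  go : ∀ k → Acc _<_ (n ∸ k) → ∀ α → 1 ≤ k → k ≤ n → Sets.inSk n st k α → ⟦ α ⟧ᶜ σ
  go k (acc rec) α 1≤k k≤n α∈Sₖ with ≤-<-connex k m
  ... | inj₂ m<k = highS k α m<k k≤n α∈Sₖ
  ... | inj₁ k≤m with rep k 1≤k k≤n α α∈Sₖ
  ...   | inj₁ (r , β , r≤k , β∈D , β→α) =
          β→α σ (Extends-antimono k≤m ext) (lowD r β (≤-trans r≤k k≤m) β∈D)
  ...   | inj₂ (inj₁ (r , j , β , r≤k , k<j , j≤n , β∈S , β→α)) =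
          β→α σ (Extends-antimono k≤m ext)
            (go j (rec (∸-monoʳ-< k<j j≤n)) β (≤-trans 1≤k (<⇒≤ k<j)) j≤n
                (r , ≤-<-trans r≤k k<j , β∈S))
  ...   | inj₂ (inj₂ τ⊨α) = τ⊨α σ (Extends-antimono k≤m ext)

module Backtrack (τ : Trail) (m : ℕ) (st : DB) (X : List Clause) where

  st' : DB
  st' = backtrackStep (suc m) X st

  module Old = Sets (suc m) st
  module New = Sets m st'

  inP-old⇒new : ∀ c → Old.inP c → New.inP c
  inP-old⇒new c (inj₁ c∈D₀) = inj₁ (∈-++⁺ˡ c∈D₀)
  inP-old⇒new c (inj₂ (k , 1≤k , k≤1+m , c∈S)) with m≤n⇒m<n∨m≡n k≤1+m
  ... | inj₁ k<1+m = inj₂ (k , 1≤k , ≤-pred k<1+m , c∈S)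
  ... | inj₂ refl  = inj₁ (∈-++⁺ʳ (D st 0) c∈S)

  inP-new⇒old : ∀ c → New.inP c → Old.inP c
  inP-new⇒old c (inj₁ c∈D₀') with ∈-++⁻ (D st 0) c∈D₀'
  ... | inj₁ c∈D₀ = inj₁ c∈D₀
  ... | inj₂ c∈S  = inj₂ (suc m , s≤s z≤n , ≤-refl , c∈S)
  inP-new⇒old c (inj₂ (k , 1≤k , k≤m , c∈S)) = inj₂ (k , 1≤k , m≤n⇒m≤1+n k≤m , c∈S)

  inA⊎inS-new⇒old : All (λ c → c ∈ D st (suc m)) X →
                    ∀ c → New.inA c ⊎ New.inS c → Old.inA c ⊎ Old.inS c
  inA⊎inS-new⇒old _ c (inj₁ (inj₁ (inj₁ c∈D₀'))) with ∈-++⁻ (D st 0) c∈D₀'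
  ... | inj₁ c∈D₀ = inj₁ (inj₁ (inj₁ c∈D₀))
  ... | inj₂ c∈S  = inj₂ (suc m , s≤s z≤n , ≤-refl , 0 , s≤s z≤n , c∈S)
  inA⊎inS-new⇒old _ c (inj₁ (inj₁ (inj₂ (r , 1≤r , r≤m , c∈Dᵣ')))) with ∈-++⁻ (D st r) c∈Dᵣ'
  ... | inj₁ c∈Dᵣ = inj₁ (inj₁ (inj₂ (r , 1≤r , m≤n⇒m≤1+n r≤m , c∈Dᵣ)))
  ... | inj₂ c∈S  = inj₂ (suc m , s≤s z≤n , ≤-refl , r , s≤s r≤m , c∈S)
  inA⊎inS-new⇒old X⊆Dᵢ c (inj₁ (inj₂ c∈D∞')) with ∈-++⁻ (D∞ st) c∈D∞'
  ... | inj₁ c∈D∞ = inj₁ (inj₂ c∈D∞)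
  ... | inj₂ c∈X  = inj₁ (inj₁ (inj₂ (suc m , s≤s z≤n , ≤-refl , lookup X⊆Dᵢ c∈X)))
  inA⊎inS-new⇒old _ c (inj₂ (k , 1≤k , k≤m , c∈S)) = inj₂ (k , 1≤k , m≤n⇒m≤1+n k≤m , c∈S)

  closure-preserved : All (λ c → c ∈ D st (suc m)) X → Closure τ (suc m) st → Closure τ m st'
  closure-preserved X⊆Dᵢ cl γ γ∈ σ ext σ⊨P' =
    cl γ (inA⊎inS-new⇒old X⊆Dᵢ γ γ∈) σ ext (⟦⟧ˢ-antimono inP-old⇒new σ⊨P')

  representation⇒N→P : Representation τ (suc m) st → Imp τ m ⟦ New.inN ⟧ˢ ⟦ New.inP ⟧ˢ
  representation⇒N→P rep σ ext σ⊨N c (inj₁ c∈D₀') = σ⊨N c (inj₁ c∈D₀')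
  representation⇒N→P rep σ ext σ⊨N c (inj₂ (k , 1≤k , k≤m , c∈S)) =
    stashed-satisfied {n = suc m} {st = st} {m = m} rep ext
      (λ r β r≤m β∈D → σ⊨N β (D-group⇒inN m st' r≤m (∈-++⁺ˡ β∈D)))
      top-satisfied
      k c 1≤k (m≤n⇒m≤1+n k≤m) (0 , 1≤k , c∈S)
    where
    top-satisfied : ∀ k α → m < k → k ≤ suc m → Old.inSk k α → ⟦ α ⟧ᶜ σ
    top-satisfied k α m<k k≤1+m (q , s≤s q≤m , α∈S) with refl ← ≤-antisym k≤1+m m<k =
      σ⊨N α (D-group⇒inN m st' q≤m (∈-++⁺ʳ (D st q) α∈S))

  representation-preserved : Representation τ (suc m) st → Representation τ m st'
  representation-preserved rep i' 1≤i' i'≤m α α∈S with rep i' 1≤i' (m≤n⇒m≤1+n i'≤m) α α∈S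
  ... | inj₁ (r , β , r≤i' , β∈D , β→α) = inj₁ (r , β , r≤i' , ∈-++⁺ˡ β∈D , β→α)
  ... | inj₂ (inj₂ τ⊨α) = inj₂ (inj₂ τ⊨α)
  ... | inj₂ (inj₁ (r , j , β , r≤i' , i'<j , j≤1+m , β∈S , β→α)) with m≤n⇒m<n∨m≡n j≤1+m
  ...   | inj₁ j<1+m = inj₂ (inj₁ (r , j , β , r≤i' , i'<j , ≤-pred j<1+m , β∈S , β→α))
  ...   | inj₂ refl  = inj₁ (r , β , r≤i' , ∈-++⁺ʳ (D st r) β∈S , β→α)

lemma5 : (I : List Clause) → All WFClause I → (τ : Trail) → WFTrail I τ →
         (m : ℕ) → (st : DB) → IsState (suc m) st → Invariants I τ (suc m) st →
         (X : List Clause) → All (λ c → c ∈ D st (suc m)) X →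
         Invariants I τ m (backtrackStep (suc m) X st)
lemma5 I _ τ _ m st _ inv X X⊆Dᵢ = record
  { inputEquivalence = Iff-congʳ inP-old⇒new inP-new⇒old inputEquivalence
  ; correctness      = λ σ ext → representation⇒N→P representation σ ext
                                 , closure⇒P→N m st' closure' σ ext
  ; representation   = representation-preserved representation
  ; closure          = closure'
  }
  where
  open Invariants inv
  open Backtrack τ m st X

  closure' : Closure τ m st'
  closure' = closure-preserved X⊆Dᵢ closure
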